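{- There is a 2-factorization of the complete graph $K_{21}$ consisting of exactly $9$ $C_3$-factors and $1$ $C_7$-factor.
   Context: A $C_k$-factor of a graph $G$ is a spanning subgraph of $G$ each of whose components is a cycle of length $k$. A 2-factorization of $G$ is a partition of the edge set of $G$ into spanning 2-regular subgraphs (2-factors). -}

module Defs where

open import Data.Nat using (ℕ; suc; _≤_)
open import Data.Nat.DivMod using (_mod_)
open import Data.Fin using (Fin; toℕ)
open import Data.Product using (Σ; ∃; _×_)
open import Data.Sum using (_⊎_)
open import Relation.Binary.PropositionalEquality using (_≡_; _≢_)
open import Level using (0ℓ)

Graph : ℕ → Set₁
Graph n = Fin n → Fin n → Set

next : {k : ℕ} → Fin (suc k) → Fin (suc k)
next {k} i = suc (toℕ i) mod (suc k)

-- H is a C_k-factor of K_n: the vertex set is partitioned into t cycles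
-- cyc a : Fin k → Fin n (a : Fin t), each listing the k distinct vertices of
-- a cycle in cyclic order, and the edges of H are exactly the edges
-- {cyc a i , cyc a (i+1 mod k)} of these cycles.  (k ≥ 3 so these are cycles.)
IsCkFactor : {n : ℕ} → (k : ℕ) → Graph n → Set
IsCkFactor {n} k H =
  3 ≤ k × Σ ℕ λ t → Σ (Fin t → Fin k → Fin n) λ cyc →
    ((v : Fin n) → Σ (Fin t) λ a → Σ (Fin k) λ i → cyc a i ≡ v)
    × ((a b : Fin t) (i j : Fin k) → cyc a i ≡ cyc b j → (a ≡ b × i ≡ j))
    × ((u v : Fin n) →
        (H u v → Σ (Fin t) λ a → Σ (Fin k) λ i → CycEdge k (cyc a) i u v)
        × ((a : Fin t) (i : Fin k) → CycEdge k (cyc a) i u v → H u v))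
  where
  CycEdge : (k : ℕ) → (Fin k → Fin n) → Fin k → Fin n → Fin n → Set
  CycEdge (suc k') c i u v =
    (c i ≡ u × c (next i) ≡ v) ⊎ (c i ≡ v × c (next i) ≡ u)
  CycEdge _ c i u v = Σ (Fin 0) λ _ → u ≡ v  -- unreachable (k ≥ 3)

-- F is a 2-factorization of K_n into m factors: each factor is a spanning
-- subgraph of K_n (loopless edge relation), and every edge {u,v} (u ≢ v) of
-- K_n lies in exactly one factor.  (That each factor is 2-regular is
-- guaranteed in the statement by requiring each to be a C_k-factor.)
IsEdgePartitionOfK : {n m : ℕ} → (Fin m → Graph n) → Set
IsEdgePartitionOfK {n} {m} F =
  ((j : Fin m) (u v : Fin n) → F j u v → u ≢ v)
  × ((u v : Fin n) → u ≢ v → Σ (Fin m) λ j → F j u v)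
  × ((u v : Fin n) (j j' : Fin m) → F j u v → F j' u v → j ≡ j')

-- Take the vertices to be ℤ₇ × ℤ₃. The C₇-factor consists of the three heptagons ℤ₇ × {b}.
-- Seven of the C₃-factors are the ℤ₇-translates of one base factor, and the remaining two
-- are the ℤ₇-orbits of the triangles {(0,0),(0,1),(0,2)} and {(0,0),(1,1),(3,2)}.
-- That these ten factors partition the edges of K₂₁ is then a finite check, decided by evaluation.
module Submission where

open import Defs
open import Data.Fin using (Fin; zero; suc; toℕ; inject₁; fromℕ; splitAt)
open import Data.Fin.Properties using (toℕ<n; toℕ-fromℕ<; toℕ-injective; all?; any?)
open import Data.Nat using (ℕ; suc; _+_; _*_; _≤_; _%_; s≤s)
open import Data.Nat.DivMod using (_mod_; m≤n⇒m%n≡m; n%n≡0)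
open import Data.Nat.Properties using (1+n≢n; 1+n≢0; m≤n⇒m<n∨m≡n; ≤-pred; _≤?_)
  renaming (_≟_ to _≟ℕ_)
open import Data.Product using (Σ; _×_; _,_; proj₂)
open import Data.Sum using (_⊎_; inj₁; inj₂; [_,_]′)
open import Data.Vec using (Vec; []; _∷_; lookup)
open import Data.Vec.Functional using (Vector; insertAt)
open import Function using (_∘_)
open import Relation.Binary.PropositionalEquality
open import Relation.Nullary using (Dec; ¬?)
open import Relation.Nullary.Decidable using (map′; _×-dec_; _⊎-dec_; _→-dec_; toWitness)

next-irreflexive : ∀ {k} (i : Fin (suc (suc k))) → next i ≢ i
next-irreflexive {k} i next≡i with m≤n⇒m<n∨m≡n (≤-pred (toℕ<n i))
... | inj₁ i<1+k = 1+n≢n (begin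
  suc (toℕ i)                  ≡⟨ m≤n⇒m%n≡m i<1+k ⟨
  suc (toℕ i) % suc (suc k)    ≡⟨ toℕ-fromℕ< _ ⟨
  toℕ (next i)                 ≡⟨ cong toℕ next≡i ⟩
  toℕ i                        ∎)
  where open ≡-Reasoning
... | inj₂ i≡1+k = 1+n≢0 (begin
  suc k                        ≡⟨ i≡1+k ⟨
  toℕ i                        ≡⟨ cong toℕ next≡i ⟨
  toℕ (next i)                 ≡⟨ toℕ-fromℕ< _ ⟩
  suc (toℕ i) % suc (suc k)    ≡⟨ cong (λ m → suc m % suc (suc k)) i≡1+k ⟩
  suc (suc k) % suc (suc k)    ≡⟨ n%n≡0 (suc (suc k)) ⟩
  0                            ∎)
  where open ≡-Reasoning

-- Compares indices as builtin naturals: evaluates much faster than Data.Fin.Properties._≟_.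
_≟_ : ∀ {n} → (x y : Fin n) → Dec (x ≡ y)
x ≟ y = map′ toℕ-injective (cong toℕ) (toℕ x ≟ℕ toℕ y)

insertAt-last : ∀ {a} {A : Set a} {n} (xs : Vector A n) (x : A) (j : Fin n) →
                insertAt xs (fromℕ n) x (inject₁ j) ≡ xs j
insertAt-last xs x zero    = refl
insertAt-last xs x (suc j) = insertAt-last (xs ∘ suc) x j

-- Cycle lengths are stored as predecessors, so that `next` applies.
record CycleSystem (n : ℕ) : Set where
  field
    count pred-length : ℕ
    cycle : Fin count → Fin (suc pred-length) → Fin n

module _ {n : ℕ} (S : CycleSystem n) where
  open CycleSystem S

  CycleEdge : Fin count → Fin (suc pred-length) → Fin n → Fin n → Set
  CycleEdge a i u v =
    (cycle a i ≡ u × cycle a (next i) ≡ v) ⊎ (cycle a i ≡ v × cycle a (next i) ≡ u)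

  Edges : Graph n
  Edges u v = Σ (Fin count) λ a → Σ (Fin (suc pred-length)) λ i → CycleEdge a i u v

  Covering : Set
  Covering = (v : Fin n) → Σ (Fin count) λ a → Σ (Fin (suc pred-length)) λ i → cycle a i ≡ v

  Disjoint : Set
  Disjoint = (a b : Fin count) (i j : Fin (suc pred-length)) →
             cycle a i ≡ cycle b j → a ≡ b × i ≡ j

  IsCyclePartition : Set
  IsCyclePartition = 3 ≤ suc pred-length × Covering × Disjoint

  edges? : (u v : Fin n) → Dec (Edges u v)
  edges? u v = any? λ a → any? λ i →
    ((cycle a i ≟ u) ×-dec (cycle a (next i) ≟ v)) ⊎-dec
    ((cycle a i ≟ v) ×-dec (cycle a (next i) ≟ u))

  isCyclePartition? : Dec IsCyclePartition
  isCyclePartition? =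
    (3 ≤? suc pred-length)
    ×-dec (all? λ v → any? λ a → any? λ i → cycle a i ≟ v)
    ×-dec (all? λ a → all? λ b → all? λ i → all? λ j →
             (cycle a i ≟ cycle b j) →-dec ((a ≟ b) ×-dec (i ≟ j)))

  Edges-sym : ∀ {u v} → Edges u v → Edges v u
  Edges-sym (a , i , inj₁ e) = a , i , inj₂ e
  Edges-sym (a , i , inj₂ e) = a , i , inj₁ e

  Edges-irreflexive : IsCyclePartition → ∀ {u v} → Edges u v → u ≢ v
  Edges-irreflexive (s≤s (s≤s _) , _ , disjoint) (a , i , inj₁ (refl , refl)) eq =
    next-irreflexive i (sym (proj₂ (disjoint a a i (next i) eq)))
  Edges-irreflexive (s≤s (s≤s _) , _ , disjoint) (a , i , inj₂ (refl , refl)) eq =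
    next-irreflexive i (proj₂ (disjoint a a (next i) i eq))

  isCkFactor : IsCyclePartition → IsCkFactor (suc pred-length) Edges
  isCkFactor (3≤k , covering , disjoint) =
    3≤k , count , cycle , covering , disjoint , λ u v → (λ e → e) , λ a i e → a , i , e

module _ {n m : ℕ} (S : Fin m → CycleSystem n) where
  open CycleSystem

  CoversEdges : Set
  CoversEdges = (u v : Fin n) → u ≢ v → Σ (Fin m) λ j → Edges (S j) u v

  EdgeDisjoint : Set
  EdgeDisjoint = (j j' : Fin m) (a : Fin (count (S j))) (i : Fin (suc (pred-length (S j)))) →
                 Edges (S j') (cycle (S j) a i) (cycle (S j) a (next i)) → j ≡ j'

  coversEdges? : Dec CoversEdges
  coversEdges? = all? λ u → all? λ v → ¬? (u ≟ v) →-dec any? λ j → edges? (S j) u v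

  edgeDisjoint? : Dec EdgeDisjoint
  edgeDisjoint? = all? λ j → all? λ j' → all? λ a → all? λ i →
    edges? (S j') _ _ →-dec (j ≟ j')

  isEdgePartition : (∀ j → IsCyclePartition (S j)) → CoversEdges → EdgeDisjoint →
                    IsEdgePartitionOfK (λ j → Edges (S j))
  isEdgePartition partitions covers disjoint =
    (λ j _ _ → Edges-irreflexive (S j) (partitions j)) , covers , unique
    where
    unique : (u v : Fin n) (j j' : Fin m) → Edges (S j) u v → Edges (S j') u v → j ≡ j'
    unique u v j j' (a , i , inj₁ (refl , refl)) e' = disjoint j j' a i e'
    unique u v j j' (a , i , inj₂ (refl , refl)) e' = disjoint j j' a i (Edges-sym (S j') e')

-- The vertex (x mod 7 , b mod 3) of ℤ₇ × ℤ₃ is numbered 7 b + x.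
Point : Set
Point = ℕ × ℕ

point : Point → Fin 21
point (x , b) = (x % 7 + 7 * (b % 3)) mod 21

translate : ℕ → Point → Point
translate s (x , b) = (s + x , b)

baseFactor : Vec (Vec Point 3) 7
baseFactor =
  ((0 , 0) ∷ (6 , 2) ∷ (4 , 2) ∷ []) ∷
  ((0 , 1) ∷ (1 , 0) ∷ (3 , 0) ∷ []) ∷
  ((0 , 2) ∷ (1 , 1) ∷ (5 , 0) ∷ []) ∷
  ((1 , 2) ∷ (3 , 1) ∷ (5 , 1) ∷ []) ∷
  ((2 , 0) ∷ (6 , 0) ∷ (4 , 1) ∷ []) ∷
  ((2 , 1) ∷ (6 , 1) ∷ (3 , 2) ∷ []) ∷
  ((2 , 2) ∷ (4 , 0) ∷ (5 , 2) ∷ []) ∷ []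

orbitBases : Vec (Vec Point 3) 2
orbitBases =
  ((0 , 0) ∷ (0 , 1) ∷ (0 , 2) ∷ []) ∷
  ((0 , 0) ∷ (1 , 1) ∷ (3 , 2) ∷ []) ∷ []

triangles : Fin 9 → Fin 7 → Fin 3 → Fin 21
triangles = [ translatedBase , orbit ∘ lookup orbitBases ]′ ∘ splitAt 7
  where
  translatedBase : Fin 7 → Fin 7 → Fin 3 → Fin 21
  translatedBase s a i = point (translate (toℕ s) (lookup (lookup baseFactor a) i))
  orbit : Vec Point 3 → Fin 7 → Fin 3 → Fin 21
  orbit T a i = point (translate (toℕ a) (lookup T i))

triangleFactor : Fin 9 → CycleSystem 21
triangleFactor j = record { count = 7 ; pred-length = 2 ; cycle = triangles j }

heptagonFactor : CycleSystem 21
heptagonFactor = record { count = 3 ; pred-length = 6 ; cycle = λ b x → point (toℕ x , toℕ b) }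

factors : Fin 10 → CycleSystem 21
factors = insertAt triangleFactor (fromℕ 9) heptagonFactor

factors-partition : ∀ j → IsCyclePartition (factors j)
factors-partition = toWitness {a? = all? (isCyclePartition? ∘ factors)} _

factors-coverEdges : CoversEdges factors
factors-coverEdges = toWitness {a? = coversEdges? factors} _

factors-edgeDisjoint : EdgeDisjoint factors
factors-edgeDisjoint = toWitness {a? = edgeDisjoint? factors} _

factors-inject₁ : ∀ j → factors (inject₁ j) ≡ triangleFactor j
factors-inject₁ = insertAt-last triangleFactor heptagonFactor

lemma3p3 : Σ (Fin 10 → Graph 21) λ F →
             IsEdgePartitionOfK F
             × ((j : Fin 9) → IsCkFactor 3 (F (inject₁ j)))
             × IsCkFactor 7 (F (fromℕ 9))
lemma3p3 =
  (λ j → Edges (factors j)) ,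
  isEdgePartition factors factors-partition factors-coverEdges factors-edgeDisjoint ,
  triangleFactors ,
  isCkFactor heptagonFactor (factors-partition (fromℕ 9))
  where
  triangleFactors : (j : Fin 9) → IsCkFactor 3 (Edges (factors (inject₁ j)))
  triangleFactors j rewrite factors-inject₁ j =
    isCkFactor (triangleFactor j) (subst IsCyclePartition (factors-inject₁ j) (factors-partition (inject₁ j)))
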